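{- Let $n\ge3$ and let $\mathsf{C}_n(t;i,j)$ be the graph obtained from the cycle graph on vertices $v_1,\dots,v_n$ (edges $v_av_{a+1}$ for $1\le a\le n-1$ and $v_nv_1$) by adding one further edge between $v_i$ and $v_j$, where $2\le t\le\lceil n/2\rceil$, $1\le i<j\le t$ and $j\ne i+1$, with marked (ramified) vertices $v_1$ and $v_t$. Then \[ F_2(\mathsf{C}_n(t;i,j))=\begin{cases}(t-1)(n-t+1)&\text{if } i=1\text{ and }j=t,\\ (n-t+1)\big[(t-j+i)(j-i+1)-1\big]&\text{otherwise.}\end{cases} \]
   Context: For a graph with two marked vertices, $F_2$ is the number of spanning forests with exactly two connected components, each containing exactly one marked vertex. -}

module Defs where

open import Data.Nat using (ℕ; zero; suc; _+_; _*_; _∸_; _≤_; _<_; ⌈_/2⌉)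
open import Data.Fin using (Fin)
open import Data.Fin.Subset using (Subset; _∈_)
open import Data.List using (List; []; _∷_; _++_; map; upTo; length; lookup; [_])
open import Data.List.Relation.Unary.Unique.Propositional using (Unique)
import Data.List.Membership.Propositional as LM
open import Data.Product using (Σ; _×_; _,_; ∃)
open import Data.Sum using (_⊎_)
open import Relation.Nullary using (¬_)
open import Relation.Binary.PropositionalEquality using (_≡_)
open import Relation.Binary.Construct.Closure.ReflexiveTransitive using (Star)
open import Function.Bundles using (_⇔_)

-- A finite simple graph: vertices are the natural numbers 1..n
-- (vertex v_a is the number a), edges are given as a list of
-- unordered pairs (x , y).
Edges : Set
Edges = List (ℕ × ℕ)

cycleEdges : ℕ → Edges
cycleEdges n = map (λ a → (suc a , suc (suc a))) (upTo (n ∸ 1)) ++ [ (n , 1) ]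

Cnij : ℕ → ℕ → ℕ → Edges
Cnij n i j = cycleEdges n ++ [ (i , j) ]

-- A spanning subgraph is given by a subset S of the edges.
EdgeSubset : Edges → Set
EdgeSubset E = Subset (length E)

Adj : (E : Edges) → EdgeSubset E → ℕ → ℕ → Set
Adj E S x y = Σ (Fin (length E)) λ k → k ∈ S ×
  ((lookup E k ≡ (x , y)) ⊎ (lookup E k ≡ (y , x)))

Connected : (E : Edges) → EdgeSubset E → ℕ → ℕ → Set
Connected E S = Star (Adj E S)

data Path (E : Edges) (S : EdgeSubset E) : ℕ → List ℕ → ℕ → Set where
  [] : ∀ {x} → Path E S x [] x
  _∷_ : ∀ {x y z vs} → Adj E S x y → Path E S y vs z → Path E S x (y ∷ vs) z

Cycle : (E : Edges) → EdgeSubset E → Set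
Cycle E S = Σ ℕ λ x → Σ ℕ λ y → Σ ℕ λ z → Σ (List ℕ) λ vs → Σ ℕ λ w →
  Unique (x ∷ y ∷ z ∷ vs) × Path E S x (y ∷ z ∷ vs) w × Adj E S w x

Acyclic : (E : Edges) → EdgeSubset E → Set
Acyclic E S = ¬ Cycle E S

TwoRootedForest : (n : ℕ) (E : Edges) (r₁ r₂ : ℕ) → EdgeSubset E → Set
TwoRootedForest n E r₁ r₂ S =
  Acyclic E S ×
  (∀ x → 1 ≤ x → x ≤ n → Connected E S x r₁ ⊎ Connected E S x r₂) ×
  ¬ Connected E S r₁ r₂

HasCount : {A : Set} → (A → Set) → ℕ → Set
HasCount {A} P k = Σ (List A) λ xs →
  Unique xs × (∀ a → (a LM.∈ xs) ⇔ P a) × length xs ≡ k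

F₂≡ : (n : ℕ) (E : Edges) (r₁ r₂ : ℕ) → ℕ → Set
F₂≡ n E r₁ r₂ k = HasCount (TwoRootedForest n E r₁ r₂) k

-- A two-rooted spanning forest of C_n(t; i, j) is the graph minus three edges b, u, v: b on the arc
-- v_t … v_n v_1, v on the arc v_i … v_j or the chord, and u on the arcs v_1 … v_i or v_j … v_t, or the
-- chord when v is not. Conversely, every such triple gives a forest: deleting b and v leaves a tree,
-- acyclic because its edges can be oriented away from a root along a strictly increasing rank, and the
-- vertices between u (or v) and b form the component of v_t. A forest misses at least one edge of each of
-- these zones (otherwise v_1 and v_t are joined, or the chord closes a cycle with the arc v_i … v_j) and at
-- most one, since the vertices between two missing edges would be cut off from both roots. Hence there are
-- (n − t + 1)((t − j + i − 1)(j − i + 1) + (j − i)) forests.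

module Submission where

open import Defs
open import Data.Bool using (Bool; true; false; not)
open import Data.Bool.Properties using (not-¬; ¬-not)
import Data.Bool.Properties as Bool
open import Data.Empty using (⊥; ⊥-elim)
open import Data.Fin as Fin using (Fin; toℕ; fromℕ<)
open import Data.Fin.Properties using (toℕ<n; toℕ-fromℕ<; fromℕ<-toℕ)
open import Data.List using (List; []; _∷_; _++_; map; applyUpTo; iterate; length; lookup; cartesianProduct; [_])
open import Data.List.Properties using (length-++; length-map; length-iterate)
open import Data.List.Membership.Propositional using (_∈_; _∉_)
open import Data.List.Membership.Propositional.Properties
  using (∈-++⁺ˡ; ∈-++⁺ʳ; ∈-++⁻; ∈-map⁺; ∈-map⁻; ∈-cartesianProduct⁺; ∈-cartesianProduct⁻)
open import Data.List.Relation.Unary.All as All using (All; []; _∷_)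
open import Data.List.Relation.Unary.All.Properties using (All¬⇒¬Any) renaming (map⁺ to All-map⁺)
open import Data.List.Relation.Unary.AllPairs using (AllPairs; []; _∷_)
open import Data.List.Relation.Unary.Any using (here; there)
open import Data.List.Relation.Unary.Unique.Propositional using (Unique)
import Data.List.Relation.Unary.Unique.Propositional.Properties as Unique
open import Data.Nat
open import Data.Nat.Properties
open import Data.Nat.Tactic.RingSolver using (solve-∀)
open import Data.Product using (∃-syntax; _×_; _,_; proj₁; proj₂)
open import Data.Sum as Sum using (_⊎_; inj₁; inj₂)
open import Data.Unit using (⊤)
import Data.Vec as Vec
open import Data.Vec.Properties using ([]=⇒lookup; lookup⇒[]=; lookup∘tabulate; tabulate∘lookup; tabulate-cong)
open import Function using (_∘_)
open import Function.Bundles using (_⇔_; mk⇔; Equivalence)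
open import Relation.Binary.Construct.Closure.ReflexiveTransitive using (Star; ε; _◅_; _◅◅_)
  renaming (reverse to Star-reverse)
open import Relation.Binary.Definitions using (tri<; tri≈; tri>)
open import Relation.Binary.PropositionalEquality hiding ([_])
open import Relation.Nullary using (¬_; Dec; yes; no; does)
open import Relation.Nullary.Decidable using (_×-dec_; _⊎-dec_)

Star-preserves : ∀ {R : ℕ → ℕ → Set} (P : ℕ → Set) → (∀ {x y} → R x y → P x → P y) →
                 ∀ {x y} → Star R x y → P x → P y
Star-preserves P step ε         px = px
Star-preserves P step (r ◅ rs) px = Star-preserves P step rs (step r px)

∈-iterate-suc⁻ : ∀ {a d k} → k ∈ iterate suc a d → a ≤ k × k < a + d
∈-iterate-suc⁻ {a} {suc d} (here refl) = ≤-refl , m<m+n a (s≤s z≤n)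
∈-iterate-suc⁻ {a} {suc d} {k} (there k∈) with ∈-iterate-suc⁻ k∈
... | a<k , k<a+d = <⇒≤ a<k , subst (k <_) (sym (+-suc a d)) k<a+d

∈-iterate-suc⁺ : ∀ {a d k} → a ≤ k → k < a + d → k ∈ iterate suc a d
∈-iterate-suc⁺ {a} {zero} {k} a≤k k<a+0 = ⊥-elim (<⇒≱ k<a+0 (subst (_≤ k) (sym (+-identityʳ a)) a≤k))
∈-iterate-suc⁺ {a} {suc d} {k} a≤k k<a+d with m≤n⇒m<n∨m≡n a≤k
... | inj₂ refl = here refl
... | inj₁ a<k  = there (∈-iterate-suc⁺ a<k (subst (k <_) (+-suc a d) k<a+d))

iterate-suc-unique : ∀ a d → Unique (iterate suc a d)
iterate-suc-unique a zero    = []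
iterate-suc-unique a (suc d) =
  All.tabulate (λ k∈ → <⇒≢ (proj₁ (∈-iterate-suc⁻ k∈))) ∷ iterate-suc-unique (suc a) d

interval : ℕ → ℕ → List ℕ
interval a c = iterate suc a (c ∸ a)

∈-interval⁻ : ∀ {a c k} → a ≤ c → k ∈ interval a c → a ≤ k × k < c
∈-interval⁻ {a} {c} {k} a≤c k∈ with ∈-iterate-suc⁻ k∈
... | a≤k , k<c = a≤k , subst (k <_) (m+[n∸m]≡n a≤c) k<c

∈-interval⁺ : ∀ {a c k} → a ≤ k → k < c → k ∈ interval a c
∈-interval⁺ {a} {c} {k} a≤k k<c = ∈-iterate-suc⁺ a≤k (subst (k <_) (sym (m+[n∸m]≡n (≤-trans a≤k (<⇒≤ k<c)))) k<c)

interval-unique : ∀ a c → Unique (interval a c)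
interval-unique a c = iterate-suc-unique a (c ∸ a)

length-interval : ∀ a c → length (interval a c) ≡ c ∸ a
length-interval a c = length-iterate suc a (c ∸ a)

length-cartesianProduct : ∀ {A B : Set} (xs : List A) (ys : List B) →
                          length (cartesianProduct xs ys) ≡ length xs * length ys
length-cartesianProduct []       ys = refl
length-cartesianProduct (x ∷ xs) ys =
  trans (length-++ (map (x ,_) ys)) (cong₂ _+_ (length-map (x ,_) ys) (length-cartesianProduct xs ys))

unique-map⁺ : ∀ {A B : Set} {P : A → Set} (f : A → B) → (∀ {x y} → P x → P y → f x ≡ f y → x ≡ y) →
              ∀ {xs} → All P xs → Unique xs → Unique (map f xs)
unique-map⁺ f injective []         []             = []
unique-map⁺ f injective (px ∷ pxs) (x∉xs ∷ unique) =
  All-map⁺ (All.zipWith (λ (x≢y , py) fx≡fy → x≢y (injective px py fx≡fy)) (x∉xs , pxs)) ∷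
  unique-map⁺ f injective pxs unique

not-does≡false⇔ : ∀ {A : Set} (a? : Dec A) → not (does a?) ≡ false ⇔ A
not-does≡false⇔ (yes a) = mk⇔ (λ _ → a) (λ _ → refl)
not-does≡false⇔ (no ¬a) = mk⇔ (λ ()) (⊥-elim ∘ ¬a)

≡-not-does : ∀ {A : Set} {b : Bool} (a? : Dec A) → (A → b ≡ false) → (b ≡ false → A) → b ≡ not (does a?)
≡-not-does (yes a) to _    = to a
≡-not-does (no ¬a) _  from = ¬-not (¬a ∘ from)

module Orientation {E : Edges} {S : EdgeSubset E} (rank parent : ℕ → ℕ) where

  _↗_ : ℕ → ℕ → Set
  x ↗ y = rank x < rank y × parent y ≡ x

  NonBacktracking : List ℕ → Set
  NonBacktracking (a ∷ b ∷ c ∷ l) = a ≢ c × NonBacktracking (b ∷ c ∷ l)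
  NonBacktracking _               = ⊤

  unique⇒nonBacktracking : ∀ l → AllPairs _≢_ l → NonBacktracking l
  unique⇒nonBacktracking []              _                      = _
  unique⇒nonBacktracking (_ ∷ [])        _                      = _
  unique⇒nonBacktracking (_ ∷ _ ∷ [])    _                      = _
  unique⇒nonBacktracking (a ∷ b ∷ c ∷ l) ((_ ∷ a≢c ∷ _) ∷ dist) =
    a≢c , unique⇒nonBacktracking (b ∷ c ∷ l) dist

  nonBacktracking-tail : ∀ {a} l → NonBacktracking (a ∷ l) → NonBacktracking l
  nonBacktracking-tail []          _        = _
  nonBacktracking-tail (_ ∷ [])    _        = _
  nonBacktracking-tail (_ ∷ _ ∷ _) (_ , nb) = nb

  path-last∈ : ∀ {a b c vs w} → Path E S a (b ∷ c ∷ vs) w → w ∈ c ∷ vs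
  path-last∈ (_ ∷ _ ∷ [])         = here refl
  path-last∈ (_ ∷ b~c ∷ c~d ∷ p) = there (path-last∈ (b~c ∷ c~d ∷ p))

  module _ (oriented : ∀ {x y} → Adj E S x y → x ↗ y ⊎ y ↗ x) where

    -- once a walk without backtracking steps away from the root, it never turns back
    ascending : ∀ {a b vs c} → Path E S a (b ∷ vs) c → a ↗ b → NonBacktracking (a ∷ b ∷ vs) →
                rank a < rank c × parent c ∈ a ∷ b ∷ vs
    ascending (_ ∷ [])        a↗b _ = proj₁ a↗b , here (proj₂ a↗b)
    ascending (_ ∷ b~c ∷ p) a↗b (a≢c , nb) with oriented b~c
    ... | inj₁ b↗c = let r , m = ascending (b~c ∷ p) b↗c nb in <-trans (proj₁ a↗b) r , there m
    ... | inj₂ c↗b = ⊥-elim (a≢c (trans (sym (proj₂ a↗b)) (proj₂ c↗b)))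

    descending-or-ascending : ∀ {a vs c} → Path E S a vs c → NonBacktracking (a ∷ vs) →
                              rank c ≤ rank a ⊎ parent c ∈ a ∷ vs
    descending-or-ascending []              _  = inj₁ ≤-refl
    descending-or-ascending {vs = vs} (a~b ∷ p) nb with oriented a~b
    ... | inj₁ a↗b = inj₂ (proj₂ (ascending (a~b ∷ p) a↗b nb))
    ... | inj₂ b↗a with descending-or-ascending p (nonBacktracking-tail vs nb)
    ...   | inj₁ r = inj₁ (≤-trans r (<⇒≤ (proj₁ b↗a)))
    ...   | inj₂ m = inj₂ (there m)

    oriented⇒acyclic : Acyclic E S
    oriented⇒acyclic (x , y , z , vs , w , distinct@(x≢ ∷ y≢ ∷ _) , x~y ∷ y⇝w , w~x) =
      closing (oriented x~y) y⇝w (oriented w~x)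
      where
      nb : NonBacktracking (x ∷ y ∷ z ∷ vs)
      nb = unique⇒nonBacktracking _ distinct
      x∉ : x ∉ y ∷ z ∷ vs
      x∉ = All¬⇒¬Any x≢
      y∉ : y ∉ z ∷ vs
      y∉ = All¬⇒¬Any y≢
      closing : x ↗ y ⊎ y ↗ x → Path E S y (z ∷ vs) w → w ↗ x ⊎ x ↗ w → ⊥
      closing (inj₁ x↗y) (y~z ∷ z⇝w) w~x with oriented y~z
      ... | inj₂ z↗y = proj₁ nb (trans (sym (proj₂ x↗y)) (proj₂ z↗y))
      ... | inj₁ y↗z with ascending (y~z ∷ z⇝w) y↗z (proj₂ nb) | w~x
      ...   | r , _ | inj₁ w↗x = <-irrefl refl (<-trans (proj₁ w↗x) (<-trans (proj₁ x↗y) r))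
      ...   | _ , m | inj₂ x↗w = x∉ (subst (_∈ y ∷ z ∷ vs) (proj₂ x↗w) m)
      closing (inj₂ y↗x) _ (inj₁ w↗x) =
        y∉ (subst (_∈ z ∷ vs) (trans (sym (proj₂ w↗x)) (proj₂ y↗x)) (path-last∈ (x~y ∷ y⇝w)))
      closing (inj₂ y↗x) y⇝w (inj₂ x↗w) with descending-or-ascending y⇝w (proj₂ nb)
      ... | inj₁ r = <-irrefl refl (<-≤-trans (proj₁ x↗w) (≤-trans r (<⇒≤ (proj₁ y↗x))))
      ... | inj₂ m = x∉ (subst (_∈ y ∷ z ∷ vs) (proj₂ x↗w) m)

module CycleWithChord (m ci cj : ℕ) where

  E : Edges
  E = Cnij (suc m) ci cj

  data EdgeIndex : ℕ → ℕ × ℕ → Set where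
    path  : ∀ {k} → k < m → EdgeIndex k (suc k , suc (suc k))
    wrap  : EdgeIndex m (suc m , 1)
    chord : EdgeIndex (suc m) (ci , cj)

  EdgeIndex-functional : ∀ {k e e′} → EdgeIndex k e → EdgeIndex k e′ → e ≡ e′
  EdgeIndex-functional (path _)  (path _)  = refl
  EdgeIndex-functional (path k<m) wrap     = ⊥-elim (<-irrefl refl k<m)
  EdgeIndex-functional (path k<m) chord    = ⊥-elim (<-asym k<m (n<1+n m))
  EdgeIndex-functional wrap     (path k<m) = ⊥-elim (<-irrefl refl k<m)
  EdgeIndex-functional wrap      wrap      = refl
  EdgeIndex-functional chord    (path k<m) = ⊥-elim (<-asym k<m (n<1+n m))
  EdgeIndex-functional chord     chord     = refl

  EdgeIndex-bound : ∀ {k e} → EdgeIndex k e → k ≤ suc m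
  EdgeIndex-bound (path k<m) = m≤n⇒m≤1+n (<⇒≤ k<m)
  EdgeIndex-bound wrap       = n≤1+n m
  EdgeIndex-bound chord      = ≤-refl

  private
    -- E = edgesFrom id m, generalised so that lookups can be computed by induction on l
    edgesFrom : (ℕ → ℕ) → ℕ → Edges
    edgesFrom g l = (map (λ a → (suc a , suc (suc a))) (applyUpTo g l) ++ [ (suc m , 1) ]) ++ [ (ci , cj) ]

    length-edgesFrom : ∀ g l → length (edgesFrom g l) ≡ suc (suc l)
    length-edgesFrom g zero    = refl
    length-edgesFrom g (suc l) = cong suc (length-edgesFrom (g ∘ suc) l)

    lookup-edgesFrom : ∀ g l (f : Fin (length (edgesFrom g l))) →
        (toℕ f < l × lookup (edgesFrom g l) f ≡ (suc (g (toℕ f)) , suc (suc (g (toℕ f)))))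
      ⊎ (toℕ f ≡ l × lookup (edgesFrom g l) f ≡ (suc m , 1))
      ⊎ (toℕ f ≡ suc l × lookup (edgesFrom g l) f ≡ (ci , cj))
    lookup-edgesFrom g zero    Fin.zero             = inj₂ (inj₁ (refl , refl))
    lookup-edgesFrom g zero    (Fin.suc Fin.zero)   = inj₂ (inj₂ (refl , refl))
    lookup-edgesFrom g (suc l) Fin.zero             = inj₁ (s≤s z≤n , refl)
    lookup-edgesFrom g (suc l) (Fin.suc f) with lookup-edgesFrom (g ∘ suc) l f
    ... | inj₁ (f<l , eq)        = inj₁ (s≤s f<l , eq)
    ... | inj₂ (inj₁ (f≡l , eq)) = inj₂ (inj₁ (cong suc f≡l , eq))
    ... | inj₂ (inj₂ (f≡l , eq)) = inj₂ (inj₂ (cong suc f≡l , eq))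

  length-E : length E ≡ suc (suc m)
  length-E = length-edgesFrom (λ a → a) m

  lookup-E : ∀ f → EdgeIndex (toℕ f) (lookup E f)
  lookup-E f with lookup-edgesFrom (λ a → a) m f
  ... | inj₁ (f<m , eq)        = subst (EdgeIndex (toℕ f)) (sym eq) (path f<m)
  ... | inj₂ (inj₁ (f≡m , eq))  = subst₂ EdgeIndex (sym f≡m) (sym eq) wrap
  ... | inj₂ (inj₂ (f≡m+1 , eq)) = subst₂ EdgeIndex (sym f≡m+1) (sym eq) chord

  -- the membership function of an edge subset, indexed by edge number (false beyond the last edge)
  present : EdgeSubset E → ℕ → Bool
  present S k with k <? length E
  ... | yes k<N = Vec.lookup S (fromℕ< k<N)
  ... | no _    = false

  present-toℕ : ∀ S f → present S (toℕ f) ≡ Vec.lookup S f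
  present-toℕ S f with toℕ f <? length E
  ... | yes f<N = cong (Vec.lookup S) (fromℕ<-toℕ f f<N)
  ... | no f≮N  = ⊥-elim (f≮N (toℕ<n f))

  Gap : EdgeSubset E → ℕ → Set
  Gap S k = present S k ≡ false

  present-tabulate : ∀ (g : ℕ → Bool) {k} → k < length E → present (Vec.tabulate (g ∘ toℕ)) k ≡ g k
  present-tabulate g {k} k<N = begin
    present S k            ≡⟨ cong (present S) (sym (toℕ-fromℕ< k<N)) ⟩
    present S (toℕ f)      ≡⟨ present-toℕ S f ⟩
    Vec.lookup S f         ≡⟨ lookup∘tabulate (g ∘ toℕ) f ⟩
    g (toℕ f)              ≡⟨ cong g (toℕ-fromℕ< k<N) ⟩
    g k                    ∎
    where
    open ≡-Reasoning
    S = Vec.tabulate (g ∘ toℕ)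
    f = fromℕ< k<N

  ≤ch⇒<length : ∀ {k} → k ≤ suc m → k < length E
  ≤ch⇒<length k≤ = subst (_ <_) (sym length-E) (s≤s k≤)

  toℕ≤ch : ∀ (f : Fin (length E)) → toℕ f ≤ suc m
  toℕ≤ch f = ≤-pred (subst (toℕ f <_) length-E (toℕ<n f))

  Edge : EdgeSubset E → ℕ → ℕ → Set
  Edge S x y = ∃[ k ] present S k ≡ true × EdgeIndex k (x , y)

  Adj⇒Edge : ∀ {S x y} → Adj E S x y → Edge S x y ⊎ Edge S y x
  Adj⇒Edge {S} (f , f∈S , inj₁ eq) =
    inj₁ (toℕ f , trans (present-toℕ S f) ([]=⇒lookup f∈S) , subst (EdgeIndex (toℕ f)) eq (lookup-E f))
  Adj⇒Edge {S} (f , f∈S , inj₂ eq) =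
    inj₂ (toℕ f , trans (present-toℕ S f) ([]=⇒lookup f∈S) , subst (EdgeIndex (toℕ f)) eq (lookup-E f))

  Edge⇒Adj : ∀ {S x y} → Edge S x y → Adj E S x y
  Edge⇒Adj {S} (k , sk , idx) = f , lookup⇒[]= f S lookup≡ , inj₁ (EdgeIndex-functional idx′ idx)
    where
    f : Fin (length E)
    f = fromℕ< (≤ch⇒<length (EdgeIndex-bound idx))
    toℕ-f : toℕ f ≡ k
    toℕ-f = toℕ-fromℕ< _
    lookup≡ : Vec.lookup S f ≡ true
    lookup≡ = trans (sym (present-toℕ S f)) (trans (cong (present S) toℕ-f) sk)
    idx′ : EdgeIndex k (lookup E f)
    idx′ = subst (λ i → EdgeIndex i (lookup E f)) toℕ-f (lookup-E f)

  Adj-sym : ∀ {S x y} → Adj E S x y → Adj E S y x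
  Adj-sym (f , f∈S , inj₁ eq) = f , f∈S , inj₂ eq
  Adj-sym (f , f∈S , inj₂ eq) = f , f∈S , inj₁ eq

  Connected-sym : ∀ {S x y} → Connected E S x y → Connected E S y x
  Connected-sym = Star-reverse Adj-sym

  -- the vertices strictly between the cycle edges p and q
  Between : ℕ → ℕ → ℕ → Set
  Between p q x = suc (suc p) ≤ x × x ≤ suc q

  below-∉ : ∀ {p q x} → x ≤ suc p → ¬ Between p q x
  below-∉ x≤p (p<x , _) = 1+n≰n (≤-trans p<x x≤p)

  above-∉ : ∀ {p q x} → suc q < x → ¬ Between p q x
  above-∉ q<x (_ , x≤q) = 1+n≰n (≤-trans q<x x≤q)

  at-most-one-gap : ∀ {S} {Z : ℕ → Set} → (∀ {p q} → Z p → Z q → p < q → Gap S p → Gap S q → ⊥) →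
                    ∀ {p q} → Z p → Z q → Gap S p → Gap S q → p ≡ q
  at-most-one-gap no-two {p} {q} p∈Z q∈Z gap-p gap-q with <-cmp p q
  ... | tri< p<q _ _ = ⊥-elim (no-two p∈Z q∈Z p<q gap-p gap-q)
  ... | tri≈ _ p≡q _ = p≡q
  ... | tri> _ _ q<p = ⊥-elim (no-two q∈Z p∈Z q<p gap-q gap-p)

  module _ (S : EdgeSubset E) where

    ChordPreserves : (ℕ → Set) → Set
    ChordPreserves P = present S (suc m) ≡ true → (P ci → P cj) × (P cj → P ci)

    chord-outside : ∀ {P : ℕ → Set} → ¬ P ci → ¬ P cj → ChordPreserves P
    chord-outside ¬Pi ¬Pj _ = (λ Pi → ⊥-elim (¬Pi Pi)) , (λ Pj → ⊥-elim (¬Pj Pj))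

    chord-inside : ∀ {P : ℕ → Set} → P ci → P cj → ChordPreserves P
    chord-inside Pi Pj _ = (λ _ → Pj) , (λ _ → Pi)

    chord-absent : ∀ {P : ℕ → Set} → Gap S (suc m) → ChordPreserves P
    chord-absent absent present = ⊥-elim (not-¬ present absent)

    Full : ℕ → ℕ → Set
    Full a c = ∀ k → a ≤ k → k < c → present S k ≡ true

    arc-connected : ∀ {a c} → a ≤ c → c ≤ m → Full a c → Connected E S (suc a) (suc c)
    arc-connected {c = zero}  z≤n _ _ = ε
    arc-connected {c = suc c} a≤c c<m full with m≤n⇒m<n∨m≡n a≤c
    ... | inj₂ refl = ε
    ... | inj₁ a≤c′ =
      arc-connected (≤-pred a≤c′) (<⇒≤ c<m) (λ k a≤k k<c → full k a≤k (m<n⇒m<1+n k<c))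
      ◅◅ Edge⇒Adj (c , full c (≤-pred a≤c′) ≤-refl , path c<m) ◅ ε

    within-arc : ∀ {a c x y} → c ≤ m → Full a c →
                 suc a ≤ x → x ≤ suc c → suc a ≤ y → y ≤ suc c → Connected E S x y
    within-arc {a} {c} c≤m full a<x x≤c a<y y≤c = Connected-sym (from-start a<x x≤c) ◅◅ from-start a<y y≤c
      where
      from-start : ∀ {x} → suc a ≤ x → x ≤ suc c → Connected E S (suc a) x
      from-start {suc x} (s≤s a≤x) (s≤s x≤c) =
        arc-connected a≤x (≤-trans x≤c c≤m) (λ k a≤k k<x → full k a≤k (<-≤-trans k<x x≤c))

    arc-path : ∀ {a} d → a + d ≤ m → Full a (a + d) →
               Path E S (suc a) (iterate suc (suc (suc a)) d) (suc (a + d))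
    arc-path {a} zero    _      _    = subst (λ c → Path E S (suc a) [] (suc c)) (sym (+-identityʳ a)) []
    arc-path {a} (suc d) a+d<m full =
      Edge⇒Adj (a , full a ≤-refl (m<m+n a (s≤s z≤n)) , path (<-≤-trans (m<m+n a (s≤s z≤n)) a+d<m)) ∷
      subst (Path E S (suc (suc a)) _) (cong suc (sym (+-suc a d)))
            (arc-path d (subst (_≤ m) (+-suc a d) a+d<m) (λ k a<k k<a+d → full k (<⇒≤ a<k) (subst (k <_) (sym (+-suc a d)) k<a+d)))

    cycle-closing-arc : ∀ {a c} → suc (suc a) ≤ c → c ≤ m → Full a c → Adj E S (suc c) (suc a) → Cycle E S
    cycle-closing-arc {a} a+2≤c c≤m full closing with m≤n⇒∃[o]m+o≡n a+2≤c
    ... | d , refl =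
      suc a , suc (suc a) , suc (suc (suc a)) , iterate suc (suc (suc (suc (suc a)))) d , suc (a + suc (suc d)) ,
      iterate-suc-unique (suc a) (suc (suc (suc d))) ,
      arc-path (suc (suc d)) (subst (_≤ m) (sym a+d+2≡) c≤m) (λ k a≤k k<c → full k a≤k (subst (k <_) a+d+2≡ k<c)) ,
      subst (λ c → Adj E S (suc c) (suc a)) (sym a+d+2≡) closing
      where
      a+d+2≡ : a + suc (suc d) ≡ suc (suc (a + d))
      a+d+2≡ = trans (+-suc a (suc d)) (cong suc (+-suc a d))

    EdgeInvariant : (ℕ → Set) → Set
    EdgeInvariant P = ∀ {x y} → Edge S x y → (P x → P y) × (P y → P x)

    Connected-preserves : ∀ {P} → EdgeInvariant P → ∀ {x y} → Connected E S x y → P x → P y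
    Connected-preserves {P} inv = Star-preserves P step
      where
      step : ∀ {x y} → Adj E S x y → P x → P y
      step a with Adj⇒Edge a
      ... | inj₁ e = proj₁ (inv e)
      ... | inj₂ e = proj₂ (inv e)

    between-invariant : ∀ {p q} → q ≤ m → Gap S p → Gap S q →
                        ChordPreserves (Between p q) →
                        EdgeInvariant (Between p q)
    between-invariant {p} {q} q≤m sp sq chord-ok (k , sk , path k<m) = forward , backward
      where
      k≢ : ∀ {l} → Gap S l → k ≢ l
      k≢ sl refl = not-¬ sk sl
      forward : Between p q (suc k) → Between p q (suc (suc k))
      forward (p<k , k≤q) = m≤n⇒m≤1+n p<k , s≤s (≤∧≢⇒< (≤-pred k≤q) (k≢ sq))
      backward : Between p q (suc (suc k)) → Between p q (suc k)
      backward (p≤k , k<q) = s≤s (≤∧≢⇒< (≤-pred (≤-pred p≤k)) (k≢ sp ∘ sym)) , m≤n⇒m≤1+n (≤-pred k<q)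
    between-invariant {p} {q} q≤m sp sq chord-ok (_ , sk , wrap) =
      (λ (_ , m≤q) → ⊥-elim (m≢q (≤-antisym q≤m (≤-pred m≤q)))) , λ { (s≤s () , _) }
      where
      m≢q : q ≢ m
      m≢q refl = not-¬ sk sq
    between-invariant _ _ _ chord-ok (_ , sk , chord) = chord-ok sk

-- C_n(t; i, j) with n = m + 1, i = i' + 1, j = j' + 1 and t = t' + 1; as edge k < m joins v_{k+1} and
-- v_{k+2}, the arcs v_1 … v_i, v_i … v_j, v_j … v_t and v_t … v_n v_1 are the edge ranges C, P, A and B.
module TwoRooted (m i' j' t' : ℕ) (i'+2≤j' : suc (suc i') ≤ j') (j'≤t' : j' ≤ t') (t'<m : t' < m) where

  open CycleWithChord m (suc i') (suc j') public

  i'<j' : i' < j'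
  i'<j' = ≤-trans (n≤1+n _) i'+2≤j'

  InC InP InA InB InCA : ℕ → Set
  InC k  = k < i'
  InP k  = i' ≤ k × k < j'
  InA k  = j' ≤ k × k < t'
  InB k  = t' ≤ k × k ≤ m
  InCA k = InC k ⊎ InA k

  InCA⇒<t' : ∀ {k} → InCA k → k < t'
  InCA⇒<t' (inj₁ k<i') = <-trans k<i' (<-≤-trans i'<j' j'≤t')
  InCA⇒<t' (inj₂ (_ , k<t')) = k<t'

  InP⇒<t' : ∀ {k} → InP k → k < t'
  InP⇒<t' (_ , k<j') = <-≤-trans k<j' j'≤t'

  <t'⇒≤m : ∀ {k} → k < t' → k ≤ m
  <t'⇒≤m k<t' = ≤-trans (<⇒≤ k<t') (<⇒≤ t'<m)

  module SpanningTree (S : EdgeSubset E) (b β : ℕ) (t'≤b : t' ≤ b) (b≤m : b ≤ m) (gap-b : Gap S b)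
    (path≢β : ∀ {k} → k < m → present S k ≡ true → k ≢ β)
    (chord⇒InP-β : present S (suc m) ≡ true → InP β) where

    Hanging : ℕ → Set
    Hanging x = suc (suc β) ≤ x × x ≤ suc j'

    hanging? : ∀ x → Dec (Hanging x)
    hanging? x = suc (suc β) ≤? x ×-dec x ≤? suc j'

    -- rooted at v_{b+2}, parents go backwards around the cycle, except on the part of the arc P beyond β,
    -- which hangs from v_i through the chord
    rank : ℕ → ℕ
    rank x with hanging? x | suc (suc b) ≤? x
    ... | yes _ | _     = suc (suc i' + (suc j' ∸ x)) + suc m
    ... | no _  | yes _ = x
    ... | no _  | no _  = x + suc m

    predecessor : ℕ → ℕ
    predecessor zero          = zero
    predecessor (suc zero)    = suc m
    predecessor (suc (suc x)) = suc x

    parent : ℕ → ℕ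
    parent x with hanging? x | x ≟ suc j'
    ... | yes _ | yes _ = suc i'
    ... | yes _ | no _  = suc x
    ... | no _  | _     = predecessor x

    upper⇒¬hanging : ∀ {x} → suc (suc b) ≤ x → ¬ Hanging x
    upper⇒¬hanging b<x (_ , x≤j) = <⇒≱ (≤-pred (≤-trans b<x x≤j)) (≤-trans j'≤t' t'≤b)

    rank-hanging : ∀ {x} → Hanging x → rank x ≡ suc (suc i' + (suc j' ∸ x)) + suc m
    rank-hanging {x} h with hanging? x
    ... | yes _ = refl
    ... | no ¬h = ⊥-elim (¬h h)

    rank-upper : ∀ {x} → suc (suc b) ≤ x → rank x ≡ x
    rank-upper {x} b<x with hanging? x | suc (suc b) ≤? x
    ... | yes h | _      = ⊥-elim (upper⇒¬hanging b<x h)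
    ... | no _  | yes _  = refl
    ... | no _  | no b≮x = ⊥-elim (b≮x b<x)

    rank-lower : ∀ {x} → ¬ Hanging x → x < suc (suc b) → rank x ≡ x + suc m
    rank-lower {x} ¬h x<b with hanging? x | suc (suc b) ≤? x
    ... | yes h | _      = ⊥-elim (¬h h)
    ... | no _  | yes b<x = ⊥-elim (<⇒≱ x<b b<x)
    ... | no _  | no _   = refl

    parent-j : Hanging (suc j') → parent (suc j') ≡ suc i'
    parent-j h with hanging? (suc j') | suc j' ≟ suc j'
    ... | yes _ | yes _  = refl
    ... | yes _ | no j≢j = ⊥-elim (j≢j refl)
    ... | no ¬h | _      = ⊥-elim (¬h h)

    parent-hanging : ∀ {x} → Hanging x → x ≢ suc j' → parent x ≡ suc x
    parent-hanging {x} h x≢j with hanging? x | x ≟ suc j'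
    ... | yes _ | yes x≡j = ⊥-elim (x≢j x≡j)
    ... | yes _ | no _    = refl
    ... | no ¬h | _       = ⊥-elim (¬h h)

    parent-other : ∀ {x} → ¬ Hanging x → parent x ≡ predecessor x
    parent-other {x} ¬h with hanging? x
    ... | yes h = ⊥-elim (¬h h)
    ... | no _  = refl

    open Orientation {E} {S} rank parent

    lower-path-oriented : ∀ {k} → k < m → present S k ≡ true → k < b →
                          Dec (Hanging (suc k)) → Dec (Hanging (suc (suc k))) →
                          suc k ↗ suc (suc k) ⊎ suc (suc k) ↗ suc k
    lower-path-oriented {k} _ _ _ (yes hk) (yes hk′) =
      inj₂ (subst₂ _<_ (sym (rank-hanging hk′)) (sym (rank-hanging hk))
                       (+-monoˡ-< (suc m) (s≤s (+-monoʳ-< (suc i') (∸-monoʳ-< {suc j'} {suc (suc k)} {suc k} ≤-refl (proj₂ hk′))))) ,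
            parent-hanging hk (<⇒≢ (proj₂ hk′)))
    lower-path-oriented {k} _ _ k<b (yes hk) (no ¬hk′) =
      inj₁ (subst₂ _<_ (sym (rank-hanging hk)) (sym (rank-lower ¬hk′ (s≤s (s≤s k<b)))) (+-monoˡ-< (suc m) i<k+2) ,
            parent-other ¬hk′)
      where
      k≡j' : k ≡ j'
      k≡j' = ≤-antisym (≤-pred (proj₂ hk)) (≮⇒≥ (λ k<j' → ¬hk′ (≤-trans (proj₁ hk) (n≤1+n _) , s≤s k<j')))
      i<k+2 : suc (suc i' + (j' ∸ k)) < suc (suc k)
      i<k+2 rewrite k≡j' | n∸n≡0 j' | +-identityʳ i' = s≤s (s≤s i'<j')
    lower-path-oriented {k} k<m sk _ (no ¬hk) (yes hk′) = ⊥-elim (path≢β k<m sk (≤-antisym k≤β β≤k))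
      where
      β≤k : β ≤ k
      β≤k = ≤-pred (≤-pred (proj₁ hk′))
      k≤β : k ≤ β
      k≤β = ≮⇒≥ (λ β<k → ¬hk (s≤s β<k , ≤-trans (n≤1+n _) (proj₂ hk′)))
    lower-path-oriented {k} _ _ k<b (no ¬hk) (no ¬hk′) =
      inj₁ (subst₂ _<_ (sym (rank-lower ¬hk (s≤s (m≤n⇒m≤1+n k<b)))) (sym (rank-lower ¬hk′ (s≤s (s≤s k<b))))
                       (+-monoˡ-< (suc m) (n<1+n (suc k))) ,
            parent-other ¬hk′)

    path-oriented : ∀ {k} → k < m → present S k ≡ true → suc k ↗ suc (suc k) ⊎ suc (suc k) ↗ suc k
    path-oriented {k} k<m sk with <-cmp k b
    ... | tri< k<b _ _  = lower-path-oriented k<m sk k<b (hanging? _) (hanging? _)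
    ... | tri≈ _ refl _ = ⊥-elim (not-¬ sk gap-b)
    ... | tri> _ _ b<k  =
      inj₁ (subst₂ _<_ (sym (rank-upper (s≤s b<k))) (sym (rank-upper (s≤s (m≤n⇒m≤1+n b<k)))) ≤-refl ,
            parent-other (upper⇒¬hanging (s≤s (m≤n⇒m≤1+n b<k))))

    wrap-oriented : present S m ≡ true → suc m ↗ 1
    wrap-oriented sm = subst₂ _<_ (sym (rank-upper (s≤s b<m))) (sym (rank-lower ¬hanging-1 (s≤s (s≤s z≤n)))) ≤-refl ,
                       parent-other ¬hanging-1
      where
      b<m : b < m
      b<m = ≤∧≢⇒< b≤m (λ { refl → not-¬ sm gap-b })
      ¬hanging-1 : ¬ Hanging 1
      ¬hanging-1 (s≤s () , _)

    chord-oriented : present S (suc m) ≡ true → suc i' ↗ suc j'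
    chord-oriented sch = subst₂ _<_ (sym (rank-lower ¬hanging-i i<b)) (sym (rank-hanging hanging-j))
                                    (+-monoˡ-< (suc m) (s≤s (m≤m+n (suc i') (j' ∸ j')))) ,
                         parent-j hanging-j
      where
      i'≤β = proj₁ (chord⇒InP-β sch)
      β<j' = proj₂ (chord⇒InP-β sch)
      hanging-j : Hanging (suc j')
      hanging-j = s≤s β<j' , ≤-refl
      ¬hanging-i : ¬ Hanging (suc i')
      ¬hanging-i (β<i' , _) = <⇒≱ (≤-pred β<i') i'≤β
      i<b : suc i' < suc (suc b)
      i<b = s≤s (s≤s (≤-trans (<⇒≤ i'<j') (≤-trans j'≤t' t'≤b)))

    edge-oriented : ∀ {x y} → Edge S x y → x ↗ y ⊎ y ↗ x
    edge-oriented (_ , sk , path k<m) = path-oriented k<m sk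
    edge-oriented (_ , sm , wrap)     = inj₁ (wrap-oriented sm)
    edge-oriented (_ , sch , chord)   = inj₁ (chord-oriented sch)

    spanning-tree-acyclic : Acyclic E S
    spanning-tree-acyclic = oriented⇒acyclic adj-oriented
      where
      adj-oriented : ∀ {x y} → Adj E S x y → x ↗ y ⊎ y ↗ x
      adj-oriented a with Adj⇒Edge a
      ... | inj₁ e = edge-oriented e
      ... | inj₂ e = Sum.swap (edge-oriented e)

  Spanning : EdgeSubset E → Set
  Spanning S = ∀ x → 1 ≤ x → x ≤ suc m → Connected E S x 1 ⊎ Connected E S x (suc t')

  -- the cycle minus the edges r₁ ≤ r₂ < b, with the arc strictly between r₁ and r₂ attached by the chord
  module _ {S r₁ r₂ b} (r₁≤r₂ : r₁ ≤ r₂) (r₂<t' : r₂ < t') (t'≤b : t' ≤ b) (b≤m : b ≤ m)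
    (others : ∀ k → k ≤ m → k ≢ r₁ → k ≢ r₂ → k ≢ b → present S k ≡ true)
    (bridge : r₁ < r₂ → present S (suc m) ≡ true ×
      (Between r₁ r₂ (suc i') × ¬ Between r₁ r₂ (suc j') ⊎ Between r₁ r₂ (suc j') × ¬ Between r₁ r₂ (suc i'))) where

    private
      r₂<b : r₂ < b
      r₂<b = <-≤-trans r₂<t' t'≤b
      r₁≤m : r₁ ≤ m
      r₁≤m = ≤-trans r₁≤r₂ (≤-trans (<⇒≤ r₂<b) b≤m)
      r₂≤m : r₂ ≤ m
      r₂≤m = ≤-trans (<⇒≤ r₂<b) b≤m
      others-< : ∀ {k} → k < r₁ → present S k ≡ true
      others-< k<r₁ = others _ (≤-trans (<⇒≤ k<r₁) r₁≤m) (<⇒≢ k<r₁) (<⇒≢ (<-≤-trans k<r₁ r₁≤r₂))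
                        (<⇒≢ (<-trans (<-≤-trans k<r₁ r₁≤r₂) r₂<b))
      others-between : ∀ {k} → r₁ < k → k < r₂ → present S k ≡ true
      others-between r₁<k k<r₂ = others _ (≤-trans (<⇒≤ k<r₂) r₂≤m) (>⇒≢ r₁<k) (<⇒≢ k<r₂) (<⇒≢ (<-trans k<r₂ r₂<b))
      others-> : ∀ {k} → r₂ < k → k ≤ m → k ≢ b → present S k ≡ true
      others-> r₂<k k≤m = others _ k≤m (>⇒≢ (≤-<-trans r₁≤r₂ r₂<k)) (>⇒≢ r₂<k)

      outer : ∀ x → 1 ≤ x → x ≤ suc m → ¬ Between r₁ r₂ x → Connected E S x 1 ⊎ Connected E S x (suc t')
      outer x 1≤x x≤n x∉ with x ≤? suc r₁ | x ≤? suc b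
      ... | yes x≤r₁ | _       = inj₁ (within-arc S r₁≤m (λ _ _ → others-<) 1≤x x≤r₁ ≤-refl (s≤s z≤n))
      ... | no r₁≮x  | yes x≤b =
        inj₂ (within-arc S b≤m (λ _ r₂<k k<b → others-> r₂<k (≤-trans (<⇒≤ k<b) b≤m) (<⇒≢ k<b))
                         r₂<x x≤b (s≤s r₂<t') (s≤s t'≤b))
        where
        r₂<x : suc (suc r₂) ≤ x
        r₂<x = ≰⇒> (λ x≤r₂ → x∉ (≰⇒> r₁≮x , x≤r₂))
      ... | no _     | no b≮x  =
        inj₁ (within-arc S ≤-refl (λ _ b<k k<m → after-b b<k (<⇒≤ k<m)) b<x x≤n (≤-trans b<x x≤n) ≤-refl
              ◅◅ Edge⇒Adj (m , after-b (≤-pred (≤-trans b<x x≤n)) ≤-refl , wrap) ◅ ε)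
        where
        b<x : suc (suc b) ≤ x
        b<x = ≰⇒> b≮x
        after-b : ∀ {k} → b < k → k ≤ m → present S k ≡ true
        after-b b<k k≤m = others-> (<-trans r₂<b b<k) k≤m (>⇒≢ b<k)

    spanning-by-gaps : Spanning S
    spanning-by-gaps x 1≤x x≤n with (suc (suc r₁) ≤? x) ×-dec (x ≤? suc r₂)
    ... | no x∉  = outer x 1≤x x≤n x∉
    ... | yes x∈ with bridge (≤-pred (≤-trans (proj₁ x∈) (proj₂ x∈)))
    ...   | sch , crossing = via-chord crossing
      where
      to : ∀ {y} → Between r₁ r₂ y → Connected E S x y
      to (r₁<y , y≤r₂) = within-arc S r₂≤m (λ _ → others-between) (proj₁ x∈) (proj₂ x∈) r₁<y y≤r₂
      i≤n : suc i' ≤ suc m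
      i≤n = s≤s (≤-trans (<⇒≤ i'<j') (≤-trans j'≤t' (<⇒≤ t'<m)))
      j≤n : suc j' ≤ suc m
      j≤n = s≤s (≤-trans j'≤t' (<⇒≤ t'<m))
      via-chord : Between r₁ r₂ (suc i') × ¬ Between r₁ r₂ (suc j') ⊎ Between r₁ r₂ (suc j') × ¬ Between r₁ r₂ (suc i') →
                  Connected E S x 1 ⊎ Connected E S x (suc t')
      via-chord (inj₁ (i∈ , j∉)) = Sum.map (x~j ◅◅_) (x~j ◅◅_) (outer (suc j') (s≤s z≤n) j≤n j∉)
        where x~j = to i∈ ◅◅ Edge⇒Adj (suc m , sch , chord) ◅ ε
      via-chord (inj₂ (j∈ , i∉)) = Sum.map (x~i ◅◅_) (x~i ◅◅_) (outer (suc i') (s≤s z≤n) i≤n i∉)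
        where x~i = to j∈ ◅◅ Adj-sym (Edge⇒Adj (suc m , sch , chord)) ◅ ε

  separated-by : ∀ {S p q} → p < t' → t' ≤ q → q ≤ m → Gap S p → Gap S q →
                 ChordPreserves S (Between p q) → ¬ Connected E S 1 (suc t')
  separated-by {S} p<t' t'≤q q≤m sp sq chord-ok 1~t
    with Connected-preserves S (between-invariant S q≤m sp sq chord-ok) (Connected-sym 1~t) (s≤s p<t' , s≤s t'≤q)
  ... | s≤s () , _

  Triple : Set
  Triple = ℕ × ℕ × ℕ

  -- b cuts the arc B, v breaks the cycle formed by P and the chord, u separates v_1 from v_t
  Valid : Triple → Set
  Valid (b , u , v) = InB b × (InCA u × (InP v ⊎ v ≡ suc m) ⊎ u ≡ suc m × InP v)

  Deleted : Triple → ℕ → Set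
  Deleted (b , u , v) k = k ≡ b ⊎ k ≡ u ⊎ k ≡ v

  Removes : EdgeSubset E → Triple → Set
  Removes S (b , u , v) = Gap S b × Gap S u × Gap S v × (∀ k → k ≤ suc m → Gap S k → Deleted (b , u , v) k)

  Forest : EdgeSubset E → Set
  Forest S = TwoRootedForest (suc m) E 1 (suc t') S

  module Sound {S b u v} (valid : Valid (b , u , v)) (removes : Removes S (b , u , v)) where

    private
      t'≤b = proj₁ (proj₁ valid)
      b≤m  = proj₂ (proj₁ valid)
      gap-b = proj₁ removes
      gap-u = proj₁ (proj₂ removes)
      gap-v = proj₁ (proj₂ (proj₂ removes))
      only  = proj₂ (proj₂ (proj₂ removes))

    kept : ∀ k → k ≤ suc m → k ≢ b → k ≢ u → k ≢ v → present S k ≡ true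
    kept k k≤ k≢b k≢u k≢v = ¬-not λ gap → Sum.[ k≢b , Sum.[ k≢u , k≢v ] ] (only k k≤ gap)

    acyclic : Acyclic E S
    acyclic = SpanningTree.spanning-tree-acyclic S b v t'≤b b≤m gap-b path≢v chord⇒InP-v
      where
      path≢v : ∀ {k} → k < m → present S k ≡ true → k ≢ v
      path≢v _ sk refl = not-¬ sk gap-v
      chord⇒InP-v : present S (suc m) ≡ true → InP v
      chord⇒InP-v sch with proj₂ valid
      ... | inj₁ (_ , inj₁ v∈P) = v∈P
      ... | inj₁ (_ , inj₂ refl) = ⊥-elim (not-¬ sch gap-v)
      ... | inj₂ (_ , v∈P) = v∈P

    private
      chord-kept : InCA u → InP v → present S (suc m) ≡ true
      chord-kept u∈CA v∈P = kept (suc m) ≤-refl (>⇒≢ (s≤s b≤m)) (>⇒≢ (s≤s (<t'⇒≤m (InCA⇒<t' u∈CA))))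
                                                        (>⇒≢ (s≤s (<t'⇒≤m (InP⇒<t' v∈P))))
      kept-cycle : ∀ {k} → k ≤ m → k ≢ b → k ≢ u → k ≢ v → present S k ≡ true
      kept-cycle {k} k≤m = kept k (m≤n⇒m≤1+n k≤m)
      ≢ch : ∀ {k} → k ≤ m → k ≢ suc m
      ≢ch k≤m = <⇒≢ (s≤s k≤m)

    spanning : Spanning S
    spanning with proj₂ valid
    ... | inj₁ (inj₁ u<i' , inj₁ (i'≤v , v<j')) =
      spanning-by-gaps (<⇒≤ (<-≤-trans u<i' i'≤v)) (InP⇒<t' (i'≤v , v<j')) t'≤b b≤m
        (λ k k≤m k≢u k≢v k≢b → kept-cycle k≤m k≢b k≢u k≢v)
        (λ _ → chord-kept (inj₁ u<i') (i'≤v , v<j') , inj₁ ((s≤s u<i' , s≤s i'≤v) , λ (_ , j≤v) → <⇒≱ v<j' (≤-pred j≤v)))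
    ... | inj₁ (inj₂ (j'≤u , u<t') , inj₁ (i'≤v , v<j')) =
      spanning-by-gaps (<⇒≤ (<-≤-trans v<j' j'≤u)) u<t' t'≤b b≤m
        (λ k k≤m k≢v k≢u k≢b → kept-cycle k≤m k≢b k≢u k≢v)
        (λ _ → chord-kept (inj₂ (j'≤u , u<t')) (i'≤v , v<j') , inj₂ ((s≤s v<j' , s≤s j'≤u) , λ (v<i , _) → <⇒≱ (≤-pred v<i) i'≤v))
    ... | inj₁ (u∈CA , inj₂ refl) =
      spanning-by-gaps ≤-refl (InCA⇒<t' u∈CA) t'≤b b≤m (λ k k≤m k≢u _ k≢b → kept-cycle k≤m k≢b k≢u (≢ch k≤m))
        (λ u<u → ⊥-elim (<-irrefl refl u<u))
    ... | inj₂ (refl , v∈P) =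
      spanning-by-gaps ≤-refl (InP⇒<t' v∈P) t'≤b b≤m (λ k k≤m k≢v _ k≢b → kept-cycle k≤m k≢b (≢ch k≤m) k≢v)
        (λ v<v → ⊥-elim (<-irrefl refl v<v))

    separated : ¬ Connected E S 1 (suc t')
    separated with proj₂ valid
    ... | inj₁ (inj₁ u<i' , inj₁ (i'≤v , v<j')) =
      separated-by (InCA⇒<t' (inj₁ u<i')) t'≤b b≤m gap-u gap-b
        (chord-inside S {Between _ _} (s≤s u<i' , s≤s (≤-trans (<⇒≤ (<-≤-trans i'<j' j'≤t')) t'≤b))
                                      (s≤s (≤-trans u<i' (<⇒≤ i'<j')) , s≤s (≤-trans j'≤t' t'≤b)))
    ... | inj₁ (inj₂ (j'≤u , u<t') , inj₁ _) =
      separated-by u<t' t'≤b b≤m gap-u gap-b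
        (chord-outside S {Between _ _} (λ (u<i , _) → <⇒≱ (≤-pred u<i) (≤-trans (<⇒≤ i'<j') j'≤u))
                                       (λ (u<j , _) → <⇒≱ (≤-pred u<j) j'≤u))
    ... | inj₁ (u∈CA , inj₂ refl) =
      separated-by (InCA⇒<t' u∈CA) t'≤b b≤m gap-u gap-b (chord-absent S {Between _ _} gap-v)
    ... | inj₂ (refl , v∈P) =
      separated-by (InP⇒<t' v∈P) t'≤b b≤m gap-v gap-b (chord-absent S {Between _ _} gap-u)

  sound : ∀ {S x} → Valid x → Removes S x → Forest S
  sound valid removes = acyclic , spanning , separated
    where open Sound valid removes

  zone : ∀ k → k ≤ suc m → InCA k ⊎ InP k ⊎ InB k ⊎ k ≡ suc m
  zone k k≤ with k <? i' | k <? j' | k <? t' | m≤n⇒m<n∨m≡n k≤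
  ... | yes k<i' | _        | _        | _         = inj₁ (inj₁ k<i')
  ... | no k≮i'  | yes k<j' | _        | _         = inj₂ (inj₁ (≮⇒≥ k≮i' , k<j'))
  ... | no _     | no k≮j'  | yes k<t' | _         = inj₁ (inj₂ (≮⇒≥ k≮j' , k<t'))
  ... | no _     | no _     | no k≮t'  | inj₁ k<ch = inj₂ (inj₂ (inj₁ (≮⇒≥ k≮t' , ≤-pred k<ch)))
  ... | no _     | no _     | no _     | inj₂ k≡ch = inj₂ (inj₂ (inj₂ k≡ch))

  Located : EdgeSubset E → Triple → Set
  Located S (b , u , v) = (∀ {k} → InB k → Gap S k → k ≡ b) ×
                          (∀ {k} → InCA k → Gap S k → k ≡ u) ×
                          (∀ {k} → InP k → Gap S k → k ≡ v)

  located⇒deleted : ∀ {S b u v} → Located S (b , u , v) → (Gap S (suc m) → suc m ≡ u ⊎ suc m ≡ v) →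
                    ∀ k → k ≤ suc m → Gap S k → Deleted (b , u , v) k
  located⇒deleted (atB , atCA , atP) atCh k k≤ gap with zone k k≤
  ... | inj₁ k∈CA               = inj₂ (inj₁ (atCA k∈CA gap))
  ... | inj₂ (inj₁ k∈P)         = inj₂ (inj₂ (atP k∈P gap))
  ... | inj₂ (inj₂ (inj₁ k∈B))  = inj₁ (atB k∈B gap)
  ... | inj₂ (inj₂ (inj₂ refl)) = inj₂ (atCh gap)

  WithChord : (ℕ → Set) → ℕ → Set
  WithChord Z w = Z w ⊎ w ≡ suc m

  Slots : Triple → Set
  Slots (b , u , v) = InB b × WithChord InCA u × WithChord InP v

  valid⇒slots : ∀ {x} → Valid x → Slots x
  valid⇒slots (b∈B , inj₁ (u∈CA , v∈)) = b∈B , inj₁ u∈CA , v∈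
  valid⇒slots (b∈B , inj₂ (u≡ch , v∈P)) = b∈B , inj₂ u≡ch , inj₁ v∈P

  private
    withChord-excludes : ∀ {Z Z′ : ℕ → Set} → (∀ {k} → Z k → ¬ Z′ k) → (∀ {k} → Z′ k → k ≤ m) →
                         ∀ {w} → WithChord Z w → ¬ Z′ w
    withChord-excludes Z∩Z′ _  (inj₁ w∈Z) = Z∩Z′ w∈Z
    withChord-excludes _  Z′≤m (inj₂ refl) ch∈Z′ = 1+n≰n (Z′≤m ch∈Z′)

    <t'⇒∉B : ∀ {k} → k < t' → ¬ InB k
    <t'⇒∉B k<t' (t'≤k , _) = <⇒≱ k<t' t'≤k

    InCA⇒∉P : ∀ {k} → InCA k → ¬ InP k
    InCA⇒∉P (inj₁ k<i')        (i'≤k , _) = <⇒≱ k<i' i'≤k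
    InCA⇒∉P (inj₂ (j'≤k , _)) (_ , k<j') = <⇒≱ k<j' j'≤k

    withChord-≤ : ∀ {Z : ℕ → Set} {w} → (∀ {k} → Z k → k < t') → WithChord Z w → w ≤ suc m
    withChord-≤ Z<t' (inj₁ w∈Z) = m≤n⇒m≤1+n (<t'⇒≤m (Z<t' w∈Z))
    withChord-≤ _    (inj₂ refl) = ≤-refl

  removes⇒located : ∀ {S x} → Slots x → Removes S x → Located S x
  removes⇒located {S} {b , u , v} (b∈B , u∈ , v∈) (_ , _ , _ , only) = atB , atCA , atP
    where
    atB : ∀ {k} → InB k → Gap S k → k ≡ b
    atB k∈B gap with only _ (m≤n⇒m≤1+n (proj₂ k∈B)) gap
    ... | inj₁ k≡b         = k≡b
    ... | inj₂ (inj₁ refl) = ⊥-elim (withChord-excludes (<t'⇒∉B ∘ InCA⇒<t') proj₂ u∈ k∈B)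
    ... | inj₂ (inj₂ refl) = ⊥-elim (withChord-excludes (<t'⇒∉B ∘ InP⇒<t') proj₂ v∈ k∈B)
    atCA : ∀ {k} → InCA k → Gap S k → k ≡ u
    atCA k∈CA gap with only _ (m≤n⇒m≤1+n (<t'⇒≤m (InCA⇒<t' k∈CA))) gap
    ... | inj₁ refl        = ⊥-elim (<t'⇒∉B (InCA⇒<t' k∈CA) b∈B)
    ... | inj₂ (inj₁ k≡u)  = k≡u
    ... | inj₂ (inj₂ refl) = ⊥-elim (withChord-excludes (λ k∈P k∈CA → InCA⇒∉P k∈CA k∈P) (<t'⇒≤m ∘ InCA⇒<t') v∈ k∈CA)
    atP : ∀ {k} → InP k → Gap S k → k ≡ v
    atP k∈P gap with only _ (m≤n⇒m≤1+n (<t'⇒≤m (InP⇒<t' k∈P))) gap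
    ... | inj₁ refl        = ⊥-elim (<t'⇒∉B (InP⇒<t' k∈P) b∈B)
    ... | inj₂ (inj₁ refl) = ⊥-elim (withChord-excludes InCA⇒∉P (<t'⇒≤m ∘ InP⇒<t') u∈ k∈P)
    ... | inj₂ (inj₂ k≡v)  = k≡v

  slot-unique : ∀ {S} {Z : ℕ → Set} {w w′} →
                (∀ {k} → Z k → Gap S k → k ≡ w) → (∀ {k} → Z k → Gap S k → k ≡ w′) →
                WithChord Z w → WithChord Z w′ → Gap S w → Gap S w′ → w ≡ w′
  slot-unique at at′ (inj₁ w∈Z)  _             gap _    = at′ w∈Z gap
  slot-unique at at′ (inj₂ refl) (inj₁ w′∈Z)  _   gap′ = sym (at w′∈Z gap′)
  slot-unique at at′ (inj₂ refl) (inj₂ refl)   _   _    = refl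

  removes-injective : ∀ {S x y} → Valid x → Valid y → Removes S x → Removes S y → x ≡ y
  removes-injective valid valid′ = slots-injective (valid⇒slots valid) (valid⇒slots valid′)
    where
    slots-injective : ∀ {S x y} → Slots x → Slots y → Removes S x → Removes S y → x ≡ y
    slots-injective slots@(b∈B , u∈ , v∈) slots′@(b′∈B , u′∈ , v′∈)
                    removes@(gap-b , gap-u , gap-v , _) removes′@(gap-b′ , gap-u′ , gap-v′ , _)
      with removes⇒located slots removes | removes⇒located slots′ removes′
    ... | atB , atCA , atP | atB′ , atCA′ , atP′
      with slot-unique atB atB′ (inj₁ b∈B) (inj₁ b′∈B) gap-b gap-b′
         | slot-unique atCA atCA′ u∈ u′∈ gap-u gap-u′
         | slot-unique atP atP′ v∈ v′∈ gap-v gap-v′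
    ... | refl | refl | refl = refl

  module Complete {S} (forest : Forest S) where

    private
      acyclic   = proj₁ forest
      spanning  = proj₁ (proj₂ forest)
      separated = proj₂ (proj₂ forest)

    gap-or-full : ∀ a c → (∃[ k ] a ≤ k × k < c × Gap S k) ⊎ Full S a c
    gap-or-full a c with anyUpTo? (λ k → (a ≤? k) ×-dec (present S k Bool.≟ false)) c
    ... | yes (k , k<c , a≤k , gap) = inj₁ (k , a≤k , k<c , gap)
    ... | no none = inj₂ λ k a≤k k<c → ¬-not λ gap → none (k , k<c , a≤k , gap)

    -- otherwise the vertex q + 1 would be cut off from both marked vertices
    isolated : ∀ {p q} → p < q → q ≤ m → Gap S p → Gap S q → ChordPreserves S (Between p q) →
               ¬ Between p q (suc t') → ⊥
    isolated {p} {q} p<q q≤m gap-p gap-q chord-ok t∉ = escape (spanning (suc q) (s≤s z≤n) (s≤s q≤m))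
      where
      stays : ∀ {y} → Connected E S (suc q) y → Between p q y
      stays q~y = Connected-preserves S (between-invariant S q≤m gap-p gap-q chord-ok) q~y (s≤s p<q , ≤-refl)
      escape : Connected E S (suc q) 1 ⊎ Connected E S (suc q) (suc t') → ⊥
      escape (inj₁ q~1) = below-∉ (s≤s z≤n) (stays q~1)
      escape (inj₂ q~t) = t∉ (stays q~t)

    B-gap-unique : ∀ {p q} → InB p → InB q → Gap S p → Gap S q → p ≡ q
    B-gap-unique = at-most-one-gap λ (t'≤p , _) (_ , q≤m) p<q gap-p gap-q →
      isolated p<q q≤m gap-p gap-q
        (chord-outside S {Between _ _} (below-∉ (s≤s (≤-trans (<⇒≤ (<-≤-trans i'<j' j'≤t')) t'≤p))) (below-∉ (s≤s (≤-trans j'≤t' t'≤p))))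
        (below-∉ (s≤s t'≤p))

    P-gap-unique : ∀ {p q} → InP p → InP q → Gap S p → Gap S q → p ≡ q
    P-gap-unique = at-most-one-gap λ (i'≤p , _) (_ , q<j') p<q gap-p gap-q →
      isolated p<q (<t'⇒≤m (<-≤-trans q<j' j'≤t')) gap-p gap-q
        (chord-outside S {Between _ _} (below-∉ (s≤s i'≤p)) (above-∉ (s≤s q<j')))
        (above-∉ (s≤s (<-≤-trans q<j' j'≤t')))

    CA-gap-unique : ∀ {p q} → InCA p → InCA q → Gap S p → Gap S q → p ≡ q
    CA-gap-unique = at-most-one-gap no-two
      where
      no-two : ∀ {p q} → InCA p → InCA q → p < q → Gap S p → Gap S q → ⊥
      no-two {p} {q} p∈ q∈ p<q gap-p gap-q =
        isolated p<q (<t'⇒≤m (InCA⇒<t' q∈)) gap-p gap-q (chord-ok p∈ q∈) (above-∉ (s≤s (InCA⇒<t' q∈)))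
        where
        chord-ok : InCA p → InCA q → ChordPreserves S (Between p q)
        chord-ok (inj₁ p<i') (inj₁ q<i') =
          chord-outside S {Between _ _} (above-∉ (s≤s q<i')) (above-∉ (s≤s (<-trans q<i' i'<j')))
        chord-ok (inj₁ p<i') (inj₂ (j'≤q , _)) =
          chord-inside S {Between _ _} (s≤s p<i' , s≤s (≤-trans (<⇒≤ i'<j') j'≤q)) (s≤s (<-trans p<i' i'<j') , s≤s j'≤q)
        chord-ok (inj₂ (j'≤p , _)) (inj₁ q<i') = ⊥-elim (<-asym p<q (<-≤-trans q<i' (≤-trans (<⇒≤ i'<j') j'≤p)))
        chord-ok (inj₂ (j'≤p , _)) (inj₂ _) =
          chord-outside S {Between _ _} (below-∉ (s≤s (≤-trans (<⇒≤ i'<j') j'≤p))) (below-∉ (s≤s j'≤p))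

    private
      t'≤m = <⇒≤ t'<m
      j'≤m = ≤-trans j'≤t' t'≤m

    gap-in-B : ∃[ b ] InB b × Gap S b
    gap-in-B with gap-or-full t' (suc m)
    ... | inj₁ (b , t'≤b , b≤m , gap) = b , (t'≤b , ≤-pred b≤m) , gap
    ... | inj₂ full = ⊥-elim (separated (Adj-sym (Edge⇒Adj (m , full m t'≤m ≤-refl , wrap)) ◅ Connected-sym t~n))
      where
      t~n : Connected E S (suc t') (suc m)
      t~n = arc-connected S t'≤m ≤-refl (λ k t'≤k k<m → full k t'≤k (m<n⇒m<1+n k<m))

    gap-in-CA : Connected E S (suc i') (suc j') → ∃[ u ] InCA u × Gap S u
    gap-in-CA i~j with gap-or-full 0 i' | gap-or-full j' t'
    ... | inj₁ (u , _ , u<i' , gap) | _                              = u , inj₁ u<i' , gap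
    ... | inj₂ _                    | inj₁ (u , j'≤u , u<t' , gap) = u , inj₂ (j'≤u , u<t') , gap
    ... | inj₂ fullC                | inj₂ fullA =
      ⊥-elim (separated (arc-connected S z≤n (<t'⇒≤m (<-≤-trans i'<j' j'≤t')) fullC ◅◅ i~j ◅◅ arc-connected S j'≤t' t'≤m fullA))

    gap-in-P : present S (suc m) ≡ true → ∃[ v ] InP v × Gap S v
    gap-in-P sch with gap-or-full i' j'
    ... | inj₁ (v , i'≤v , v<j' , gap) = v , (i'≤v , v<j') , gap
    ... | inj₂ fullP = ⊥-elim (acyclic (cycle-closing-arc S i'+2≤j' j'≤m fullP (Adj-sym (Edge⇒Adj (suc m , sch , chord)))))

    no-CA-gap : Gap S (suc m) → ∀ {v} → InP v → Gap S v → ∀ {k} → InCA k → Gap S k → ⊥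
    no-CA-gap absent (i'≤v , v<j') gap-v (inj₁ k<i') gap-k =
      isolated (<-≤-trans k<i' i'≤v) (<t'⇒≤m (<-≤-trans v<j' j'≤t')) gap-k gap-v (chord-absent S {Between _ _} absent)
               (above-∉ (s≤s (<-≤-trans v<j' j'≤t')))
    no-CA-gap absent (i'≤v , v<j') gap-v (inj₂ (j'≤k , k<t')) gap-k =
      isolated (<-≤-trans v<j' j'≤k) (<t'⇒≤m k<t') gap-v gap-k (chord-absent S {Between _ _} absent) (above-∉ (s≤s k<t'))

    private
      atB : ∀ {b} → InB b → Gap S b → ∀ {k} → InB k → Gap S k → k ≡ b
      atB b∈B gap-b k∈B gap = B-gap-unique k∈B b∈B gap gap-b
      atCA : ∀ {u} → InCA u → Gap S u → ∀ {k} → InCA k → Gap S k → k ≡ u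
      atCA u∈CA gap-u k∈CA gap = CA-gap-unique k∈CA u∈CA gap gap-u
      atP : ∀ {v} → InP v → Gap S v → ∀ {k} → InP k → Gap S k → k ≡ v
      atP v∈P gap-v k∈P gap = P-gap-unique k∈P v∈P gap gap-v

    complete : ∃[ x ] Valid x × Removes S x
    complete with gap-in-B | present S (suc m) in chord-state
    ... | b , b∈B , gap-b | true =
      let v , v∈P , gap-v   = gap-in-P chord-state
          u , u∈CA , gap-u = gap-in-CA (Edge⇒Adj (suc m , chord-state , chord) ◅ ε)
      in (b , u , v) , (b∈B , inj₁ (u∈CA , inj₁ v∈P)) ,
         (gap-b , gap-u , gap-v ,
          located⇒deleted (atB b∈B gap-b , atCA u∈CA gap-u , atP v∈P gap-v) (λ gap → ⊥-elim (not-¬ chord-state gap)))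
    ... | b , b∈B , gap-b | false with gap-or-full i' j'
    ...   | inj₂ fullP =
      let u , u∈CA , gap-u = gap-in-CA (arc-connected S (<⇒≤ i'<j') j'≤m fullP)
      in (b , u , suc m) , (b∈B , inj₁ (u∈CA , inj₂ refl)) ,
         (gap-b , gap-u , chord-state ,
          located⇒deleted (atB b∈B gap-b , atCA u∈CA gap-u , (λ (i'≤k , k<j') gap → ⊥-elim (not-¬ (fullP _ i'≤k k<j') gap)))
                          (λ _ → inj₂ refl))
    ...   | inj₁ (v , i'≤v , v<j' , gap-v) =
      (b , suc m , v) , (b∈B , inj₂ (refl , (i'≤v , v<j'))) ,
      (gap-b , chord-state , gap-v ,
       located⇒deleted (atB b∈B gap-b , (λ k∈CA gap → ⊥-elim (no-CA-gap chord-state (i'≤v , v<j') gap-v k∈CA gap)) ,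
                        atP (i'≤v , v<j') gap-v)
                       (λ _ → inj₁ refl))

  CAs Ps Bs : List ℕ
  CAs = interval 0 i' ++ interval j' t'
  Ps  = interval i' j'
  Bs  = interval t' (suc m)

  Pairs : List (ℕ × ℕ)
  Pairs = cartesianProduct CAs (Ps ++ [ suc m ]) ++ map (suc m ,_) Ps

  Triples : List Triple
  Triples = cartesianProduct Bs Pairs

  private
    ∈CAs⁻ : ∀ {u} → u ∈ CAs → InCA u
    ∈CAs⁻ u∈ with ∈-++⁻ (interval 0 i') u∈
    ... | inj₁ u∈C = inj₁ (proj₂ (∈-interval⁻ z≤n u∈C))
    ... | inj₂ u∈A = inj₂ (∈-interval⁻ j'≤t' u∈A)

    ∈CAs⁺ : ∀ {u} → InCA u → u ∈ CAs
    ∈CAs⁺ (inj₁ u<i')        = ∈-++⁺ˡ (∈-interval⁺ z≤n u<i')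
    ∈CAs⁺ (inj₂ (j'≤u , u<t')) = ∈-++⁺ʳ (interval 0 i') (∈-interval⁺ j'≤u u<t')

    ∈Ps⁻ : ∀ {v} → v ∈ Ps → InP v
    ∈Ps⁻ = ∈-interval⁻ (<⇒≤ i'<j')

    ∈Ps⁺ : ∀ {v} → InP v → v ∈ Ps
    ∈Ps⁺ (i'≤v , v<j') = ∈-interval⁺ i'≤v v<j'

    ∈Ps+ch⁻ : ∀ {v} → v ∈ Ps ++ [ suc m ] → InP v ⊎ v ≡ suc m
    ∈Ps+ch⁻ v∈ with ∈-++⁻ Ps v∈
    ... | inj₁ v∈P         = inj₁ (∈Ps⁻ v∈P)
    ... | inj₂ (here v≡ch) = inj₂ v≡ch

    ∈Ps+ch⁺ : ∀ {v} → InP v ⊎ v ≡ suc m → v ∈ Ps ++ [ suc m ]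
    ∈Ps+ch⁺ (inj₁ v∈P)  = ∈-++⁺ˡ (∈Ps⁺ v∈P)
    ∈Ps+ch⁺ (inj₂ refl) = ∈-++⁺ʳ Ps (here refl)

  ∈Triples⁻ : ∀ {x} → x ∈ Triples → Valid x
  ∈Triples⁻ x∈ with ∈-cartesianProduct⁻ Bs _ x∈
  ... | b∈ , uv∈ with ∈-interval⁻ (m≤n⇒m≤1+n (<⇒≤ t'<m)) b∈ | ∈-++⁻ (cartesianProduct CAs (Ps ++ [ suc m ])) uv∈
  ...   | t'≤b , b<ch | inj₁ uv∈CA×P =
    (t'≤b , ≤-pred b<ch) , inj₁ (∈CAs⁻ (proj₁ (∈-cartesianProduct⁻ CAs _ uv∈CA×P)) , ∈Ps+ch⁻ (proj₂ (∈-cartesianProduct⁻ CAs _ uv∈CA×P)))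
  ...   | t'≤b , b<ch | inj₂ uv∈ch×P with ∈-map⁻ (suc m ,_) uv∈ch×P
  ...     | _ , v∈P , refl = (t'≤b , ≤-pred b<ch) , inj₂ (refl , ∈Ps⁻ v∈P)

  ∈Triples⁺ : ∀ {x} → Valid x → x ∈ Triples
  ∈Triples⁺ ((t'≤b , b≤m) , uv) = ∈-cartesianProduct⁺ (∈-interval⁺ t'≤b (s≤s b≤m)) (pairs uv)
    where
    pairs : ∀ {u v} → InCA u × (InP v ⊎ v ≡ suc m) ⊎ u ≡ suc m × InP v → (u , v) ∈ Pairs
    pairs (inj₁ (u∈CA , v∈)) = ∈-++⁺ˡ (∈-cartesianProduct⁺ (∈CAs⁺ u∈CA) (∈Ps+ch⁺ v∈))
    pairs (inj₂ (refl , v∈P)) = ∈-++⁺ʳ (cartesianProduct CAs (Ps ++ [ suc m ])) (∈-map⁺ (suc m ,_) (∈Ps⁺ v∈P))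

  Triples-unique : Unique Triples
  Triples-unique =
    Unique.cartesianProduct⁺ (interval-unique t' (suc m))
      (Unique.++⁺ (Unique.cartesianProduct⁺ CAs-unique Ps+ch-unique)
                  (Unique.map⁺ (λ { refl → refl }) (interval-unique i' j'))
                  λ (uv∈ , uv∈′) → chord-not-in-CAs uv∈ uv∈′)
    where
    CAs-unique : Unique CAs
    CAs-unique = Unique.++⁺ (interval-unique 0 i') (interval-unique j' t')
      λ (u∈C , u∈A) → <⇒≱ (proj₂ (∈-interval⁻ z≤n u∈C)) (≤-trans (<⇒≤ i'<j') (proj₁ (∈-interval⁻ j'≤t' u∈A)))
    Ps+ch-unique : Unique (Ps ++ [ suc m ])
    Ps+ch-unique = Unique.++⁺ (interval-unique i' j') ([] ∷ [])
      λ { (ch∈P , here refl) → 1+n≰n (<t'⇒≤m (InP⇒<t' (∈Ps⁻ ch∈P))) }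
    chord-not-in-CAs : ∀ {uv} → uv ∈ cartesianProduct CAs (Ps ++ [ suc m ]) → uv ∈ map (suc m ,_) Ps → ⊥
    chord-not-in-CAs uv∈ uv∈′ with ∈-map⁻ (suc m ,_) uv∈′
    ... | _ , _ , refl = 1+n≰n (<t'⇒≤m (InCA⇒<t' (∈CAs⁻ (proj₁ (∈-cartesianProduct⁻ CAs _ uv∈)))))

  length-Triples : length Triples ≡ suc (m ∸ t') * ((i' + (t' ∸ j')) * ((j' ∸ i') + 1) + (j' ∸ i'))
  length-Triples = begin
    length Triples                                                ≡⟨ length-cartesianProduct Bs Pairs ⟩
    length Bs * length Pairs                                      ≡⟨ cong (length Bs *_) length-Pairs ⟩
    length Bs * (length CAs * length (Ps ++ [ suc m ]) + length Ps)
      ≡⟨ cong₂ _*_ length-Bs (cong₂ _+_ (cong₂ _*_ length-CAs length-Ps+ch) (length-interval i' j')) ⟩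
    suc (m ∸ t') * ((i' + (t' ∸ j')) * ((j' ∸ i') + 1) + (j' ∸ i')) ∎
    where
    open ≡-Reasoning
    length-Pairs : length Pairs ≡ length CAs * length (Ps ++ [ suc m ]) + length Ps
    length-Pairs = trans (length-++ (cartesianProduct CAs (Ps ++ [ suc m ])))
                         (cong₂ _+_ (length-cartesianProduct CAs _) (length-map {B = ℕ × ℕ} (suc m ,_) Ps))
    length-Bs : length Bs ≡ suc (m ∸ t')
    length-Bs = trans (length-interval t' (suc m)) (+-∸-assoc 1 (<⇒≤ t'<m))
    length-CAs : length CAs ≡ i' + (t' ∸ j')
    length-CAs = trans (length-++ (interval 0 i')) (cong₂ _+_ (length-interval 0 i') (length-interval j' t'))
    length-Ps+ch : length (Ps ++ [ suc m ]) ≡ (j' ∸ i') + 1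
    length-Ps+ch = trans (length-++ Ps) (cong (_+ 1) (length-interval i' j'))

  deleted? : ∀ x k → Dec (Deleted x k)
  deleted? (b , u , v) k = k ≟ b ⊎-dec k ≟ u ⊎-dec k ≟ v

  without : Triple → EdgeSubset E
  without x = Vec.tabulate λ f → not (does (deleted? x (toℕ f)))

  removes-without : ∀ {x} → Valid x → Removes (without x) x
  removes-without {x@(b , u , v)} valid =
    gap (inj₁ refl) b≤ , gap (inj₂ (inj₁ refl)) u≤ , gap (inj₂ (inj₂ refl)) v≤ , λ k k≤ → Equivalence.to (characterised k≤)
    where
    characterised : ∀ {k} → k ≤ suc m → Gap (without x) k ⇔ Deleted x k
    characterised {k} k≤ = subst (λ p → p ≡ false ⇔ Deleted x k) (sym (present-tabulate _ (≤ch⇒<length k≤)))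
                                 (not-does≡false⇔ (deleted? x k))
    gap : ∀ {k} → Deleted x k → k ≤ suc m → Gap (without x) k
    gap del k≤ = Equivalence.from (characterised k≤) del
    slots = valid⇒slots valid
    b≤ = m≤n⇒m≤1+n (proj₂ (proj₁ slots))
    u≤ = withChord-≤ InCA⇒<t' (proj₁ (proj₂ slots))
    v≤ = withChord-≤ InP⇒<t' (proj₂ (proj₂ slots))

  removes⇒≡without : ∀ {S x} → Removes S x → S ≡ without x
  removes⇒≡without {S} {x} removes@(_ , _ , _ , only) =
    trans (sym (tabulate∘lookup S)) (tabulate-cong λ f →
      trans (sym (present-toℕ S f)) (≡-not-does (deleted? x (toℕ f)) (removes⇒gap removes) (only (toℕ f) (toℕ≤ch f))))
    where
    removes⇒gap : ∀ {x k} → Removes S x → Deleted x k → Gap S k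
    removes⇒gap (gap-b , _ , _ , _) (inj₁ refl)        = gap-b
    removes⇒gap (_ , gap-u , _ , _) (inj₂ (inj₁ refl)) = gap-u
    removes⇒gap (_ , _ , gap-v , _) (inj₂ (inj₂ refl)) = gap-v

  F₂-count : F₂≡ (suc m) E 1 (suc t') (suc (m ∸ t') * ((i' + (t' ∸ j')) * ((j' ∸ i') + 1) + (j' ∸ i')))
  F₂-count = map without Triples , unique , (λ S → mk⇔ to (from S)) , trans (length-map without Triples) length-Triples
    where
    unique : Unique (map without Triples)
    unique = unique-map⁺ without
      (λ {x} {y} valid-x valid-y without≡ →
        removes-injective valid-x valid-y (removes-without valid-x) (subst (λ S → Removes S y) (sym without≡) (removes-without valid-y)))
      (All.tabulate ∈Triples⁻) Triples-unique
    to : ∀ {S} → S ∈ map without Triples → Forest S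
    to S∈ with ∈-map⁻ without S∈
    ... | x , x∈ , refl = sound (∈Triples⁻ x∈) (removes-without (∈Triples⁻ x∈))
    from : ∀ S → Forest S → S ∈ map without Triples
    from S forest with Complete.complete forest
    ... | x , valid , removes = subst (_∈ map without Triples) (sym (removes⇒≡without removes)) (∈-map⁺ without (∈Triples⁺ valid))

private
  count-identity : ∀ M A i Y → suc M * ((i + A) * (Y + 1) + Y) ≡ (M + 1) * ((A + suc i) * (Y + 1) ∸ 1)
  count-identity M A i Y = begin
    suc M * ((i + A) * (Y + 1) + Y)       ≡⟨ cong (_* ((i + A) * (Y + 1) + Y)) (+-comm 1 M) ⟩
    (M + 1) * ((i + A) * (Y + 1) + Y)     ≡⟨ cong (λ z → (M + 1) * (z ∸ 1)) (sym (expand A i Y)) ⟩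
    (M + 1) * ((A + suc i) * (Y + 1) ∸ 1) ∎
    where
    open ≡-Reasoning
    expand : ∀ A i Y → (A + suc i) * (Y + 1) ≡ suc ((i + A) * (Y + 1) + Y)
    expand = solve-∀

  marked-ends : ∀ N t → N * ((t ∸ t + 1) * (t ∸ 1 + 1) ∸ 1) ≡ (t ∸ 1) * N
  marked-ends N t rewrite n∸n≡0 t | +-identityʳ (t ∸ 1 + 1) | m+n∸n≡m (t ∸ 1) 1 = *-comm N (t ∸ 1)

F₂-Cnij : (n t i j : ℕ) → 1 ≤ i → i < j → j ≢ i + 1 → j ≤ t → t < n →
          F₂≡ n (Cnij n i j) 1 t ((n ∸ t + 1) * ((t ∸ j + i) * (j ∸ i + 1) ∸ 1))
F₂-Cnij (suc m) (suc t') (suc i') (suc j') _ (s≤s i<j) j≢i+1 (s≤s j≤t) (s≤s t<m) =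
  subst (F₂≡ (suc m) (Cnij (suc m) (suc i') (suc j')) 1 (suc t'))
        (count-identity (m ∸ t') (t' ∸ j') i' (j' ∸ i'))
        (TwoRooted.F₂-count m i' j' t' i+2≤j j≤t t<m)
  where
  i+2≤j : suc (suc i') ≤ j'
  i+2≤j = ≤∧≢⇒< i<j (λ i+1≡j → j≢i+1 (cong suc (trans (sym i+1≡j) (+-comm 1 i'))))

proposition7p6 : (n t i j : ℕ) → 3 ≤ n → 2 ≤ t → t ≤ ⌈ n /2⌉ →
    1 ≤ i → i < j → j ≤ t → j ≢ i + 1 →
    ((i ≡ 1 × j ≡ t) →
      F₂≡ n (Cnij n i j) 1 t ((t ∸ 1) * (n ∸ t + 1))) ×
    (¬ (i ≡ 1 × j ≡ t) →
      F₂≡ n (Cnij n i j) 1 t ((n ∸ t + 1) * ((t ∸ j + i) * (j ∸ i + 1) ∸ 1)))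
-- t ≤ ⌈ n /2⌉ is only needed as t < n, and 2 ≤ t follows from 1 ≤ i < j ≤ t
proposition7p6 n@(suc (suc k)) t i j (s≤s (s≤s _)) _ t≤⌈n/2⌉ 1≤i i<j j≤t j≢i+1 = marked-chord , λ _ → F₂
  where
  F₂ : F₂≡ n (Cnij n i j) 1 t ((n ∸ t + 1) * ((t ∸ j + i) * (j ∸ i + 1) ∸ 1))
  F₂ = F₂-Cnij n t i j 1≤i i<j j≢i+1 j≤t (≤-<-trans t≤⌈n/2⌉ (⌈n/2⌉<n k))
  marked-chord : i ≡ 1 × j ≡ t → F₂≡ n (Cnij n i j) 1 t ((t ∸ 1) * (n ∸ t + 1))
  marked-chord (refl , refl) = subst (F₂≡ n (Cnij n 1 t) 1 t) (marked-ends (n ∸ t + 1) t) F₂
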